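{- Let $G$ be a finite, simple, connected chordal graph, and let $C_1, C_2, C_3$ be maximal cliques of $G$ such that $S = C_1 \cap C_2$ and $U = C_2 \cap C_3$ are minimal separators of $G$ with $S = U$. Then either $C_1C_3$ is an edge of the reduced clique graph $\mathcal{C}_r(G)$, or the two edges $C_1C_2$ and $C_2C_3$ do not both belong to a same maximal clique tree of $G$.
   Context: A graph is chordal if it has no chordless cycle of length at least $4$. A minimal separator of $G$ is a set $S$ of vertices for which there exist vertices $a,b$ that are in different connected components of $G - S$, and $S$ is inclusion-minimal with this property (for that pair). A maximal clique is a complete subgraph maximal under inclusion. The reduced clique graph $\mathcal{C}_r(G)$ is the graph whose vertices are the maximal cliques of $G$, where two maximal cliques $C, C'$ are adjacent iff for every $x \in C \setminus (C\cap C')$ and every $y \in C' \setminus (C \cap C')$, the set $C \cap C'$ is a minimal separator for $x$ and $y$ in $G$ (i.e. separates $x$ from $y$ and is inclusion-minimal with this property). A maximal clique tree of $G$ is a tree $T$ whose vertices are the maximal cliques of $G$, whose edges $CC'$ correspond to minimal separators $C\cap C'$ of $G$, and such that for every vertex $x$ of $G$ the maximal cliques containing $x$ induce a subtree of $T$. -}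

module Defs where

open import Data.Nat using (ℕ; zero; suc; _+_)
open import Data.Fin using (Fin; zero; suc; toℕ; inject₁; fromℕ)
open import Data.Fin.Subset using (Subset; _∈_; _∉_; _⊆_; _⊂_; _∩_)
open import Data.Product using (Σ; ∃; _×_; _,_)
open import Data.Sum using (_⊎_)
open import Data.Unit using (⊤)
open import Relation.Nullary using (¬_)
open import Relation.Binary using (Decidable)
open import Relation.Binary.PropositionalEquality using (_≡_; _≢_)
open import Function.Definitions using (Injective)

record Graph (n : ℕ) : Set₁ where
  field
    Adj    : Fin n → Fin n → Set
    adj?   : Decidable Adj
    sym    : ∀ {x y} → Adj x y → Adj y x
    irrefl : ∀ {x} → ¬ Adj x x

data Path {V : Set} (R : V → V → Set) (P : V → Set) : V → V → Set where
  here : ∀ {a} → P a → Path R P a a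
  step : ∀ {a b c} → P a → R a b → Path R P b c → Path R P a c

IsCycle : {V : Set} (R : V → V → Set) (m : ℕ) → (Fin (3 + m) → V) → Set
IsCycle R m c =
  Injective _≡_ _≡_ c
  × (∀ (i : Fin (2 + m)) → R (c (inject₁ i)) (c (suc i)))
  × R (c (fromℕ (2 + m))) (c zero)

CycNbr : (k : ℕ) → Fin k → Fin k → Set
CycNbr k i j =
  (suc (toℕ i) ≡ toℕ j) ⊎ (suc (toℕ j) ≡ toℕ i)
  ⊎ (toℕ i ≡ 0 × suc (toℕ j) ≡ k) ⊎ (toℕ j ≡ 0 × suc (toℕ i) ≡ k)

module _ {n : ℕ} (G : Graph n) where
  open Graph G

  ChordlessCycle : (m : ℕ) → (Fin (4 + m) → Fin n) → Set
  ChordlessCycle m c =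
    IsCycle Adj (suc m) c × (∀ i j → Adj (c i) (c j) → CycNbr (4 + m) i j)

  Chordal : Set
  Chordal = ∀ m (c : Fin (4 + m) → Fin n) → ¬ ChordlessCycle m c

  Connected : Set
  Connected = ∀ a b → Path Adj (λ _ → ⊤) a b

  Separates : Subset n → Fin n → Fin n → Set
  Separates S a b = a ∉ S × b ∉ S × ¬ Path Adj (λ v → v ∉ S) a b

  MinSepFor : Subset n → Fin n → Fin n → Set
  MinSepFor S a b = Separates S a b × (∀ S' → S' ⊂ S → ¬ Separates S' a b)

  MinimalSeparator : Subset n → Set
  MinimalSeparator S = Σ (Fin n) λ a → Σ (Fin n) λ b → MinSepFor S a b

  IsClique : Subset n → Set
  IsClique C = ∀ x y → x ∈ C → y ∈ C → x ≢ y → Adj x y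

  MaximalClique : Subset n → Set
  MaximalClique C = IsClique C × (∀ D → IsClique D → C ⊆ D → D ⊆ C)

  ReducedCliqueEdge : Subset n → Subset n → Set
  ReducedCliqueEdge C C' =
    MaximalClique C × MaximalClique C' × C ≢ C'
    × (∀ x y → (x ∈ C × x ∉ C ∩ C') → (y ∈ C' × y ∉ C ∩ C') → MinSepFor (C ∩ C') x y)

  record IsCliqueTree (T : Subset n → Subset n → Set) : Set where
    field
      vertices   : ∀ {C D} → T C D → MaximalClique C × MaximalClique D
      loopless   : ∀ {C D} → T C D → C ≢ D
      symmetric  : ∀ {C D} → T C D → T D C
      edgeSep    : ∀ {C D} → T C D → MinimalSeparator (C ∩ D)
      connected  : ∀ C D → MaximalClique C → MaximalClique D → Path T (λ _ → ⊤) C D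
      acyclic    : ∀ m (c : Fin (3 + m) → Subset n) → ¬ IsCycle T m c
      subtree    : ∀ x C D → MaximalClique C → MaximalClique D → x ∈ C → x ∈ D →
                   Path T (λ E → x ∈ E) C D

module Submission where

-- Put X = C₁ ∩ C₃.  Because C₁ and C₃ are cliques, X can never
-- fail to be *minimal* between a vertex x ∈ C₁ ∖ X and a vertex y ∈ C₃ ∖ X:
-- omitting any s ∈ X reopens the path x – s – y.  So C₁C₃ is an edge of the
-- reduced clique graph exactly when X separates every such pair, and since
-- reachability in a finite graph is decidable we may split on this.  If some
-- such x, y are joined by a path avoiding X, then no clique tree T contains
-- both C₁C₂ and C₂C₃: the path also avoids C₂ ∩ C₃ = C₁ ∩ C₂ ⊆ X, and a path
-- avoiding the separator of the tree edge C₂C₃ links cliques on the same side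
-- of that edge; so C₁ (attached to C₂) and C₃ would be joined in T without the
-- edge C₂C₃, which is impossible because every edge of a tree is a bridge.

open import Defs
open import Data.Nat using (ℕ; zero; suc; _+_; _≤_; _<_; z≤n; s≤s)
open import Data.Nat.Properties using (<⇒≤)
open import Data.Fin using (Fin; zero; suc; inject₁; fromℕ; _≟_)
open import Data.Fin.Properties using (any?; all?; injective⇒≤)
open import Data.Fin.Subset using (Subset; _∈_; _∉_; _⊆_; _⊂_; _∪_; _∩_; ⁅_⁆)
open import Data.Fin.Subset.Properties
  using (_∈?_; x∈p∩q⁺; x∈p∩q⁻; x∈p∪q⁺; x∈p∪q⁻; x∈⁅x⁆; x∈⁅y⁆⇒x≡y; p⊆p∪q)
open import Data.Bool using () renaming (_≟_ to _≟ᴮ_)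
open import Data.Vec.Properties using (≡-dec)
open import Data.List using (List; []; _∷_; allFin)
open import Data.List.Relation.Unary.Any using (here; there)
open import Data.List.Membership.Propositional using () renaming (_∈_ to _∈ˡ_)
open import Data.List.Membership.Propositional.Properties using (∈-allFin)
open import Data.Product using (Σ; _×_; _,_; proj₁; proj₂; map₁)
open import Data.Sum using (_⊎_; inj₁; inj₂)
open import Data.Unit using (⊤; tt)
open import Data.Empty using (⊥; ⊥-elim)
open import Relation.Nullary using (¬_; Dec; yes; no)
open import Relation.Nullary.Decidable using (_×-dec_; _→-dec_; ¬?)
open import Relation.Binary using (Decidable; DecidableEquality)
open import Relation.Binary.PropositionalEquality
  using (_≡_; _≢_; refl; sym; trans; subst; subst₂)
open import Function.Definitions using (Injective)

module _ {V : Set} {R : V → V → Set} where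

  head : ∀ {P a b} → Path R P a b → P a
  head (here pa)     = pa
  head (step pa _ _) = pa

  mapᵖ : ∀ {P Q : V → Set} → (∀ {v} → P v → Q v) → ∀ {a b} → Path R P a b → Path R Q a b
  mapᵖ f (here pa)     = here (f pa)
  mapᵖ f (step pa r p) = step (f pa) r (mapᵖ f p)

  infixr 5 _++ᵖ_
  _++ᵖ_ : ∀ {P a b c} → Path R P a b → Path R P b c → Path R P a c
  here _      ++ᵖ q = q
  step pa r p ++ᵖ q = step pa r (p ++ᵖ q)

-- A simple path: after leaving a vertex the path never returns to it.
data SimplePath {V : Set} (R : V → V → Set) : (V → Set) → V → V → Set₁ where
  here : ∀ {P a} → P a → SimplePath R P a a
  step : ∀ {P a b c} → P a → R a b → SimplePath R (λ v → P v × v ≢ a) b c →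
         SimplePath R P a c

module _ {V : Set} {R : V → V → Set} where

  length : ∀ {P a b} → SimplePath R P a b → ℕ
  length (here _)     = 0
  length (step _ _ s) = suc (length s)

  mapˢ : ∀ {P Q : V → Set} → (∀ {v} → P v → Q v) → ∀ {a b} →
         SimplePath R P a b → SimplePath R Q a b
  mapˢ f (here pa)     = here (f pa)
  mapˢ f (step pa r s) = step (f pa) r (mapˢ (map₁ f) s)

  forget : ∀ {P a b} → SimplePath R P a b → Path R P a b
  forget (here pa)     = here pa
  forget (step pa r s) = step pa r (mapᵖ proj₁ (forget s))

  module _ (_≟ⱽ_ : DecidableEquality V) where

    cutAt : ∀ {P b c} (a : V) → SimplePath R P b c →
            SimplePath R P a c ⊎ SimplePath R (λ v → P v × v ≢ a) b c
    cutAt a (here {a = b} pb) with b ≟ⱽ a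
    ... | yes refl = inj₁ (here pb)
    ... | no b≢a   = inj₂ (here (pb , b≢a))
    cutAt a (step {a = b} pb r s) with b ≟ⱽ a
    ... | yes refl = inj₁ (step pb r s)
    ... | no b≢a with cutAt a s
    ...   | inj₁ fromA = inj₁ (mapˢ proj₁ fromA)
    ...   | inj₂ avoidsA = inj₂ (step (pb , b≢a) r (mapˢ (λ ((p , ≢b) , ≢a) → (p , ≢a) , ≢b) avoidsA))

    -- Every path can be shortened to a simple one (cut out each return to
    -- the vertex being prepended).
    toSimple : ∀ {P a b} → Path R P a b → SimplePath R P a b
    toSimple (here pa) = here pa
    toSimple (step {a = a} pa r p) with cutAt a (toSimple p)
    ... | inj₁ fromA   = fromA
    ... | inj₂ avoidsA = step pa r avoidsA

  record Enumeration (P : V → Set) (a b : V) (k : ℕ) : Set where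
    field
      vertex    : Fin (suc k) → V
      injective : Injective _≡_ _≡_ vertex
      linked    : ∀ (i : Fin k) → R (vertex (inject₁ i)) (vertex (suc i))
      first     : vertex zero ≡ a
      last      : vertex (fromℕ k) ≡ b
      inside    : ∀ i → P (vertex i)

  enumerate : ∀ {P a b} (s : SimplePath R P a b) → Enumeration P a b (length s)
  enumerate {a = a} (here pa) = record
    { vertex = λ _ → a ; injective = λ { {zero} {zero} _ → refl }
    ; linked = λ () ; first = refl ; last = refl ; inside = λ { zero → pa } }
  enumerate {P} {a} (step pa r s) = record
    { vertex = vertex′ ; injective = injective′ ; linked = linked′
    ; first = refl ; last = last ; inside = inside′ }
    where
      open Enumeration (enumerate s)
      vertex′ : Fin (suc (suc (length s))) → V
      vertex′ zero    = a
      vertex′ (suc i) = vertex i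
      -- the tail avoids a, so a is not repeated
      injective′ : Injective _≡_ _≡_ vertex′
      injective′ {zero}  {zero}  _ = refl
      injective′ {zero}  {suc j} e = ⊥-elim (proj₂ (inside j) (sym e))
      injective′ {suc i} {zero}  e = ⊥-elim (proj₂ (inside i) e)
      injective′ {suc i} {suc j} e with injective e
      ... | refl = refl
      linked′ : ∀ i → R (vertex′ (inject₁ i)) (vertex′ (suc i))
      linked′ zero    = subst (R a) (sym first) r
      linked′ (suc i) = linked i
      inside′ : ∀ i → P (vertex′ i)
      inside′ zero    = pa
      inside′ (suc i) = proj₁ (inside i)

module _ {n : ℕ} {R : Fin n → Fin n → Set} where

  -- a simple path visits distinct vertices, so it has fewer than n edges
  length<n : ∀ {P a b} (s : SimplePath R P a b) → length s < n
  length<n s = injective⇒≤ (Enumeration.injective (enumerate s))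

  module _ (R? : Decidable R) where

    searchSimple : ∀ k {P} → (∀ v → Dec (P v)) → ∀ a b →
                   Dec (Σ (SimplePath R P a b) λ s → length s ≤ k)
    searchSimple k P? a b with P? a
    ... | no ¬pa = no λ (s , _) → ¬pa (head (forget s))
    ... | yes pa with a ≟ b
    ...   | yes refl = yes (here pa , z≤n)
    searchSimple zero P? a b | yes pa | no a≢b =
      no λ { (here _ , _) → a≢b refl ; (step _ _ _ , ()) }
    searchSimple (suc k) P? a b | yes pa | no a≢b
      with any? (λ c → R? a c ×-dec searchSimple k (λ v → P? v ×-dec ¬? (v ≟ a)) c b)
    ... | yes (c , r , s , ≤k) = yes (step pa r s , s≤s ≤k)
    ... | no none = no λ { (here _ , _) → a≢b refl
                         ; (step _ r s , s≤s ≤k) → none (_ , r , s , ≤k) }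

    reachable? : ∀ {P} → (∀ v → Dec (P v)) → ∀ a b → Dec (Path R P a b)
    reachable? P? a b with searchSimple n P? a b
    ... | yes (s , _) = yes (forget s)
    ... | no none     = no λ p → let s = toSimple _≟_ p in none (s , <⇒≤ (length<n s))

DeleteEdge : {V : Set} → (V → V → Set) → V → V → V → V → Set
DeleteEdge T C D E F = T E F × ¬ ((E ≡ C × F ≡ D) ⊎ (E ≡ D × F ≡ C))

-- In an acyclic relation the two ends of an edge are not joined once the
-- edge is deleted: a simple path between them would close a cycle.
edge-is-bridge : {V : Set} → DecidableEquality V → {T : V → V → Set} →
                 (∀ m (c : Fin (3 + m) → V) → ¬ IsCycle T m c) →
                 ∀ {C D} → T D C → C ≢ D → ¬ Path (DeleteEdge T C D) (λ _ → ⊤) C D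
edge-is-bridge _≟ⱽ_ {T} acyclic {C} {D} tDC C≢D p = noClosure (enumerate (toSimple _≟ⱽ_ p))
  where
    noClosure : ∀ {k} → Enumeration (λ _ → ⊤) C D k → ⊥
    noClosure {zero} e = C≢D (trans (sym first) last) where open Enumeration e
    noClosure {suc zero} e = proj₂ (linked zero) (inj₁ (first , last)) where open Enumeration e
    noClosure {suc (suc m)} e =
      acyclic m vertex (injective , (λ i → proj₁ (linked i)) , subst₂ T (sym last) (sym first) tDC)
      where open Enumeration e

module _ {n : ℕ} (G : Graph n) where
  open Graph G renaming (sym to Adj-sym)

  Compatible : Subset n → Fin n → Set
  Compatible C w = ∀ z → z ∈ C → z ≢ w → Adj w z

  compatible? : ∀ C w → Dec (Compatible C w)
  compatible? C w = all? λ z → (z ∈? C) →-dec ¬? (z ≟ w) →-dec adj? w z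

  adjoin : (C : Subset n) (w : Fin n) → Dec (Compatible C w) → Subset n
  adjoin C w (yes _) = C ∪ ⁅ w ⁆
  adjoin C w (no _)  = C

  adjoin-⊇ : ∀ C w d → C ⊆ adjoin C w d
  adjoin-⊇ C w (yes _) = p⊆p∪q _
  adjoin-⊇ C w (no _)  = λ x∈C → x∈C

  adjoin-clique : ∀ C w d → IsClique G C → IsClique G (adjoin C w d)
  adjoin-clique C w (no _) cl = cl
  adjoin-clique C w (yes compat) cl x y x∈ y∈ x≢y
    with x∈p∪q⁻ C ⁅ w ⁆ x∈ | x∈p∪q⁻ C ⁅ w ⁆ y∈
  ... | inj₁ x∈C | inj₁ y∈C = cl x y x∈C y∈C x≢y
  ... | inj₁ x∈C | inj₂ y∈w with x∈⁅y⁆⇒x≡y w y∈w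
  ...   | refl = Adj-sym (compat x x∈C x≢y)
  adjoin-clique C w (yes compat) cl x y x∈ y∈ x≢y | inj₂ x∈w | inj₁ y∈C
    with x∈⁅y⁆⇒x≡y w x∈w
  ... | refl = compat y y∈C (λ e → x≢y (sym e))
  adjoin-clique C w (yes compat) cl x y x∈ y∈ x≢y | inj₂ x∈w | inj₂ y∈w
    with x∈⁅y⁆⇒x≡y w x∈w | x∈⁅y⁆⇒x≡y w y∈w
  ... | refl | refl = ⊥-elim (x≢y refl)

  greedy : Subset n → List (Fin n) → Subset n
  greedy C []       = C
  greedy C (w ∷ ws) = greedy (adjoin C w (compatible? C w)) ws

  greedy-⊇ : ∀ C ws → C ⊆ greedy C ws
  greedy-⊇ C []       x∈C = x∈C
  greedy-⊇ C (w ∷ ws) x∈C = greedy-⊇ _ ws (adjoin-⊇ C w (compatible? C w) x∈C)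

  greedy-clique : ∀ C ws → IsClique G C → IsClique G (greedy C ws)
  greedy-clique C []       cl = cl
  greedy-clique C (w ∷ ws) cl = greedy-clique _ ws (adjoin-clique C w (compatible? C w) cl)

  -- a listed vertex lying in a clique above the result was adjoined: when its
  -- turn came it was compatible, as the current set lies in that clique
  greedy-saturated : ∀ C ws D w → w ∈ˡ ws → IsClique G D → greedy C ws ⊆ D → w ∈ D →
                     w ∈ greedy C ws
  greedy-saturated C (w ∷ ws) D .w (here refl) clD ⊆D w∈D with compatible? C w
  ... | yes _ = greedy-⊇ _ ws (x∈p∪q⁺ (inj₂ (x∈⁅x⁆ w)))
  ... | no incompatible = ⊥-elim (incompatible λ z z∈C z≢w →
          clD w z w∈D (⊆D (greedy-⊇ C ws z∈C)) (λ e → z≢w (sym e)))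
  greedy-saturated C (v ∷ ws) D w (there w∈ws) clD ⊆D w∈D =
    greedy-saturated _ ws D w w∈ws clD ⊆D w∈D

  extendToMaximal : ∀ C → IsClique G C → Σ (Subset n) λ K → MaximalClique G K × C ⊆ K
  extendToMaximal C cl =
    greedy C (allFin n)
    , (greedy-clique C (allFin n) cl
      , λ D clD ⊆D w∈D → greedy-saturated C (allFin n) D _ (∈-allFin _) clD ⊆D w∈D)
    , greedy-⊇ C (allFin n)

  edge-clique : ∀ {u z} → Adj u z → IsClique G (⁅ u ⁆ ∪ ⁅ z ⁆)
  edge-clique {u} {z} uz x y x∈ y∈ x≢y with x∈p∪q⁻ ⁅ u ⁆ ⁅ z ⁆ x∈ | x∈p∪q⁻ ⁅ u ⁆ ⁅ z ⁆ y∈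
  ... | inj₁ x∈u | inj₁ y∈u rewrite x∈⁅y⁆⇒x≡y u x∈u | x∈⁅y⁆⇒x≡y u y∈u = ⊥-elim (x≢y refl)
  ... | inj₁ x∈u | inj₂ y∈z rewrite x∈⁅y⁆⇒x≡y u x∈u | x∈⁅y⁆⇒x≡y z y∈z = uz
  ... | inj₂ x∈z | inj₁ y∈u rewrite x∈⁅y⁆⇒x≡y z x∈z | x∈⁅y⁆⇒x≡y u y∈u = Adj-sym uz
  ... | inj₂ x∈z | inj₂ y∈z rewrite x∈⁅y⁆⇒x≡y z x∈z | x∈⁅y⁆⇒x≡y z y∈z = ⊥-elim (x≢y refl)

  edgeInMaximalClique : ∀ {u z} → Adj u z →
                        Σ (Subset n) λ K → MaximalClique G K × u ∈ K × z ∈ K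
  edgeInMaximalClique {u} {z} uz with extendToMaximal _ (edge-clique uz)
  ... | K , mK , ⊆K = K , mK , ⊆K (x∈p∪q⁺ (inj₁ (x∈⁅x⁆ u))) , ⊆K (x∈p∪q⁺ (inj₂ (x∈⁅x⁆ z)))

module _ {n : ℕ} {G : Graph n} {T : Subset n → Subset n → Set} (tree : IsCliqueTree G T) where
  open IsCliqueTree tree
  open Graph G using (Adj)

  -- The maximal cliques containing v form a subtree, which uses the edge
  -- {C , D} only if v ∈ C ∩ D.
  subtree-avoids-edge : ∀ {C D v K K'} → v ∉ C ∩ D → MaximalClique G K → MaximalClique G K' →
                        v ∈ K → v ∈ K' → Path (DeleteEdge T C D) (λ _ → ⊤) K K'
  subtree-avoids-edge {C} {D} {v} v∉C∩D mK mK' v∈K v∈K' = avoid (subtree v _ _ mK mK' v∈K v∈K')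
    where
      avoid : ∀ {E F} → Path T (v ∈_) E F → Path (DeleteEdge T C D) (λ _ → ⊤) E F
      avoid (here _) = here tt
      avoid (step v∈E tEF q) = step tt (tEF , notCD) (avoid q)
        where
          notCD : ¬ ((_ ≡ C × _ ≡ D) ⊎ (_ ≡ D × _ ≡ C))
          notCD (inj₁ (refl , refl)) = v∉C∩D (x∈p∩q⁺ (v∈E , head q))
          notCD (inj₂ (refl , refl)) = v∉C∩D (x∈p∩q⁺ (head q , v∈E))

  -- A path of G avoiding C ∩ D links maximal cliques at its ends through T
  -- without the edge {C , D}: consecutive subtrees meet in a maximal clique
  -- containing the edge between their vertices.
  separator-confines : ∀ {C D x y} → Path Adj (_∉ C ∩ D) x y →
                       ∀ {K K'} → MaximalClique G K → MaximalClique G K' → x ∈ K → y ∈ K' →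
                       Path (DeleteEdge T C D) (λ _ → ⊤) K K'
  separator-confines (here x∉) mK mK' x∈K x∈K' = subtree-avoids-edge x∉ mK mK' x∈K x∈K'
  separator-confines (step x∉ xz p) mK mK' x∈K y∈K' with edgeInMaximalClique G xz
  ... | L , mL , x∈L , z∈L =
    subtree-avoids-edge x∉ mK mL x∈K x∈L ++ᵖ separator-confines p mL mK' z∈L y∈K'

  -- If C₁C₂ and C₂C₃ are edges of T with C₁ ∩ C₂ = C₂ ∩ C₃, then C₁ ∩ C₃
  -- separates every vertex of C₁ from every vertex of C₃: otherwise C₂ – C₁
  -- followed by the confined path from C₁ to C₃ would bypass the edge C₂C₃.
  consecutive-edges-separate : ∀ {C₁ C₂ C₃} → MaximalClique G C₁ → MaximalClique G C₃ →
                               C₁ ≢ C₃ → C₁ ∩ C₂ ≡ C₂ ∩ C₃ → T C₁ C₂ → T C₂ C₃ →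
                               ∀ {x y} → x ∈ C₁ → y ∈ C₃ → ¬ Path Adj (_∉ C₁ ∩ C₃) x y
  consecutive-edges-separate {C₁} {C₂} {C₃} mC₁ mC₃ C₁≢C₃ S≡U t₁₂ t₂₃ x∈C₁ y∈C₃ p =
    edge-is-bridge (≡-dec _≟ᴮ_) acyclic (symmetric t₂₃) (loopless t₂₃)
      (step tt (symmetric t₁₂ , notC₂C₃) (separator-confines (mapᵖ avoidsU p) mC₁ mC₃ x∈C₁ y∈C₃))
    where
      -- C₂ ∩ C₃ = C₁ ∩ C₂ is contained in C₁ ∩ C₃
      avoidsU : ∀ {v} → v ∉ C₁ ∩ C₃ → v ∉ C₂ ∩ C₃
      avoidsU v∉X v∈U = v∉X (x∈p∩q⁺ ( proj₁ (x∈p∩q⁻ C₁ C₂ (subst (_ ∈_) (sym S≡U) v∈U))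
                                   , proj₂ (x∈p∩q⁻ C₂ C₃ v∈U)))
      notC₂C₃ : ¬ ((C₂ ≡ C₂ × C₁ ≡ C₃) ⊎ (C₂ ≡ C₃ × C₁ ≡ C₂))
      notC₂C₃ (inj₁ (_ , C₁≡C₃)) = C₁≢C₃ C₁≡C₃
      notC₂C₃ (inj₂ (C₂≡C₃ , _)) = loopless t₂₃ C₂≡C₃

module _ {n : ℕ} (G : Graph n) where
  open Graph G using (Adj; adj?)

  SeparatesSides : Subset n → Subset n → Set
  SeparatesSides C C' = ∀ x y → x ∈ C → x ∉ C ∩ C' → y ∈ C' → y ∉ C ∩ C' →
                        ¬ Path Adj (_∉ C ∩ C') x y

  separatesSides? : ∀ C C' → Dec (SeparatesSides C C')
  separatesSides? C C' = all? λ x → all? λ y →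
    (x ∈? C) →-dec ¬? (x ∈? (C ∩ C')) →-dec (y ∈? C') →-dec ¬? (y ∈? (C ∩ C')) →-dec
    ¬? (reachable? adj? (λ v → ¬? (v ∈? (C ∩ C'))) x y)

  -- For cliques C, C', no proper subset S' of C ∩ C' separates x ∈ C ∖ C'
  -- from y ∈ C' ∖ C: a vertex s ∈ (C ∩ C') ∖ S' gives the path x – s – y.
  proper-subsets-fail : ∀ {C C'} → IsClique G C → IsClique G C' →
                        ∀ {x y} → x ∈ C → x ∉ C ∩ C' → y ∈ C' → y ∉ C ∩ C' →
                        ∀ S' → S' ⊂ C ∩ C' → ¬ Separates G S' x y
  proper-subsets-fail {C} {C'} clC clC' x∈C x∉ y∈C' y∉ S' (_ , s , s∈C∩C' , s∉S') (x∉S' , y∉S' , noPath) =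
    noPath (step x∉S' (clC _ s x∈C s∈C (λ { refl → x∉ s∈C∩C' }))
           (step s∉S' (clC' s _ s∈C' y∈C' (λ { refl → y∉ s∈C∩C' }))
           (here y∉S')))
    where
      s∈C  = proj₁ (x∈p∩q⁻ C C' s∈C∩C')
      s∈C' = proj₂ (x∈p∩q⁻ C C' s∈C∩C')

  reduced-edge : ∀ {C C'} → MaximalClique G C → MaximalClique G C' → C ≢ C' →
                 SeparatesSides C C' → ReducedCliqueEdge G C C'
  reduced-edge mC mC' C≢C' separated = mC , mC' , C≢C' ,
    λ x y (x∈C , x∉) (y∈C' , y∉) →
      (x∉ , y∉ , separated x y x∈C x∉ y∈C' y∉)
      , proper-subsets-fail (proj₁ mC) (proj₁ mC') x∈C x∉ y∈C' y∉

-- (7) The theorem.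

lemma4 : ∀ {n : ℕ} (G : Graph n) → Chordal G → Connected G →
         (C₁ C₂ C₃ : Subset n) →
         MaximalClique G C₁ → MaximalClique G C₂ → MaximalClique G C₃ →
         C₁ ≢ C₂ → C₂ ≢ C₃ → C₁ ≢ C₃ →
         MinimalSeparator G (C₁ ∩ C₂) → MinimalSeparator G (C₂ ∩ C₃) →
         C₁ ∩ C₂ ≡ C₂ ∩ C₃ →
         ReducedCliqueEdge G C₁ C₃
         ⊎ (∀ (T : Subset n → Subset n → Set) → IsCliqueTree G T →
              ¬ (T C₁ C₂ × T C₂ C₃))
lemma4 G _ _ C₁ C₂ C₃ mC₁ _ mC₃ _ _ C₁≢C₃ _ _ S≡U with separatesSides? G C₁ C₃
... | yes separated = inj₁ (reduced-edge G mC₁ mC₃ C₁≢C₃ separated)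
... | no notSeparated = inj₂ λ T tree (t₁₂ , t₂₃) →
  notSeparated λ x y x∈C₁ _ y∈C₃ _ →
    consecutive-edges-separate tree mC₁ mC₃ C₁≢C₃ S≡U t₁₂ t₂₃ x∈C₁ y∈C₃
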